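{- If a finite set $\mathcal C$ of propositional clauses has the termination property, then $\mathcal C$ is renamable-Horn.
   Context: A propositional literal is a Boolean variable $p$ (positive) or its negation $\neg p$ (negative). A clause is a disjunction of literals, regarded as a multiset of literals. A Horn clause is a clause with at most one positive literal. A set $\mathcal C$ of clauses has the termination property if there is no infinite sequence $c_0,c_1,c_2,\dots$ of clauses with $c_0\in\mathcal C$ and, for each $i\ge1$, $c_i$ derived by binary resolution from $c_{i-1}$ and a clause of $\mathcal C$, using the rule: from $C\vee p$ and $D\vee\neg p$ derive $C\vee D$. For a set $A$ of Boolean variables, $r_A(\mathcal C)$ is the result of replacing in $\mathcal C$ every literal whose variable is in $A$ by its complement; $\mathcal C$ is renamable-Horn if there is some set $A$ of Boolean variables such that every clause of $r_A(\mathcal C)$ is Horn. -}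

module Defs where

open import Data.Nat using (ℕ; suc; _≤_)
open import Data.Bool using (Bool; true; false; not; if_then_else_)
open import Data.List using (List; _∷_; _++_; map; filter; length)
open import Data.List.Membership.Propositional using (_∈_)
open import Data.List.Relation.Unary.All using (All)
open import Data.List.Relation.Binary.Permutation.Propositional using (_↭_)
open import Data.Product using (Σ; ∃; _×_; _,_)
open import Data.Sum using (_⊎_)
open import Relation.Nullary using (¬_)
open import Relation.Unary using (Pred)
open import Agda.Builtin.Equality using (_≡_)
open import Data.Bool.Properties using (T?)

Var : Set
Var = ℕ

record Literal : Set where
  constructor lit
  field
    var      : Var
    positive : Bool
open Literal public

-- A clause is a multiset of literals: represented as a list, considered up to
-- permutation (_↭_) wherever clauses are compared.
Clause : Set
Clause = List Literal

ResolveOn : Clause → Clause → Clause → Set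
ResolveOn c d e = Σ Var λ p → Σ Clause λ C → Σ Clause λ D →
  (c ↭ (lit p true ∷ C)) × (d ↭ (lit p false ∷ D)) × (e ↭ (C ++ D))

Resolvent : Clause → Clause → Clause → Set
Resolvent c d e = ResolveOn c d e ⊎ ResolveOn d c e

InfiniteSequence : List Clause → (ℕ → Clause) → Set
InfiniteSequence 𝒞 s =
  (s 0 ∈ 𝒞) × (∀ i → Σ Clause λ d → (d ∈ 𝒞) × Resolvent (s i) d (s (suc i)))

Termination : List Clause → Set
Termination 𝒞 = ¬ (Σ (ℕ → Clause) λ s → InfiniteSequence 𝒞 s)

Horn : Clause → Set
Horn c = length (filter (λ l → T? (positive l)) c) ≤ 1

renameLit : (Var → Bool) → Literal → Literal
renameLit A (lit v b) = lit v (if A v then not b else b)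

renameClause : (Var → Bool) → Clause → Clause
renameClause A = map (renameLit A)

rename : (Var → Bool) → List Clause → List Clause
rename A = map (renameClause A)

RenamableHorn : List Clause → Set
RenamableHorn 𝒞 = Σ (Var → Bool) λ A → All Horn (rename A 𝒞)

module Submission where

-- The proof goes through the implication graph of 𝒞: its vertices are
-- literals, with an edge a ⟶ b whenever some clause contains a and ¬b at
-- distinct positions.
--
--  * A path a₀ ⟶ a₁ ⟶ a₂ ⟶ … of the graph is a chain of clauses
--    cᵢ = aᵢ ∨ ¬aᵢ₊₁ ∨ Rᵢ, and resolving each cᵢ₊₁ against the previous
--    resolvent on aᵢ₊₁ never stops.  An infinite path therefore refutes
--    termination, and since going around a cycle forever is an infinite path,
--    the implication graph of a terminating clause set is acyclic.
--  * In a finite acyclic graph every walk is shorter than the number of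
--    edges, so the length of the longest walk out of a vertex is a rank that
--    strictly decreases along edges.
--  * Flip the variable v exactly when rank(¬v) ≤ rank(v).  A literal that is
--    positive after flipping ranks no higher than its complement, so two
--    positive literals x, y of one clause would give
--    rank x ≤ rank ¬x < rank y ≤ rank ¬y < rank x.  Hence every renamed
--    clause is Horn.

open import Defs
open import Data.Bool using (Bool; true; false; not; T)
open import Data.Bool.Properties using (not-involutive)
import Data.Bool.Properties as Bool
open import Data.Empty using (⊥; ⊥-elim)
open import Data.Unit using (tt)
open import Data.Nat using (ℕ; zero; suc; _≤_; _<_; _≤ᵇ_; z≤n; s≤s)
import Data.Nat.Properties as ℕ
open import Data.Nat.Properties using (≤-trans; ≤-reflexive; <⇒≤; ≰⇒>; <-irrefl; ≤ᵇ⇒≤; ≤⇒≤ᵇ; module ≤-Reasoning)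
open import Data.Product using (Σ; ∃; _×_; _,_; proj₁; proj₂; map₂)
open import Data.Sum using (_⊎_; inj₁; inj₂)
open import Data.List using (List; []; _∷_; _++_; map; filter; length; concatMap)
open import Data.List.Properties using (length-map; filter-none)
open import Data.List.Membership.Propositional using (_∈_; find; lose)
open import Data.List.Membership.Propositional.Properties
  using (∈-∃++; ∈-++⁺ˡ; ∈-++⁺ʳ; ∈-++⁻; ∈-map⁺; ∈-map⁻; ∈-filter⁺; ∈-filter⁻; ∈-concatMap⁺; ∈-concatMap⁻)
open import Data.List.Relation.Unary.Any using (here; there)
open import Data.List.Relation.Unary.All using (All)
import Data.List.Relation.Unary.All as All
open import Data.List.Relation.Unary.All.Properties using () renaming (map⁺ to All-map⁺)
open import Data.List.Relation.Unary.Unique.Propositional using (Unique; []; _∷_)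
open import Data.List.Relation.Binary.Permutation.Propositional using (_↭_; ↭-refl; ↭-sym; ↭-trans; ↭-prep; ↭-swap)
open import Data.List.Relation.Binary.Permutation.Propositional.Properties using (shift; ++-comm)
open import Data.List.Extrema ℕ.≤-totalOrder using (max; argmax-sel; xs≤max)
open import Function using (id)
open import Relation.Binary.Definitions using (DecidableEquality)
open import Relation.Binary.PropositionalEquality using (_≡_; refl; sym; cong; subst)
open import Relation.Nullary using (¬_; yes; no)
open import Relation.Nullary.Decidable using (map′; _×-dec_)
open import Relation.Unary using (Decidable)

private
  variable
    A B : Set
    x y : A
    xs ys : List A

∈⇒↭ : x ∈ xs → ∃ λ R → xs ↭ x ∷ R
∈⇒↭ {x = x} x∈ with ∈-∃++ x∈
... | p , q , refl = p ++ q , shift x p q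

delete : x ∈ xs → ∃ λ zs → length xs ≡ suc (length zs) × (∀ {z} → z ∈ xs → ¬ z ≡ x → z ∈ zs)
delete {xs = _ ∷ zs} (here refl) = zs , refl , λ { (here refl) z≢x → ⊥-elim (z≢x refl) ; (there z∈) _ → z∈ }
delete {xs = y ∷ _} (there x∈) =
  let zs , len , keep = delete x∈
  in y ∷ zs , cong suc len , λ { (here refl) _ → here refl ; (there z∈) z≢x → there (keep z∈ z≢x) }

unique⊆⇒length≤ : Unique xs → (∀ {z} → z ∈ xs → z ∈ ys) → length xs ≤ length ys
unique⊆⇒length≤ [] _ = z≤n
unique⊆⇒length≤ (x≢xs ∷ unique) sub =
  let zs , len , keep = delete (sub (here refl))
      rest = unique⊆⇒length≤ unique (λ z∈ → keep (sub (there z∈)) (λ { refl → All.lookup x≢xs z∈ refl }))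
  in subst (_ ≤_) (sym len) (s≤s rest)

module Graph {V : Set} (_≟_ : DecidableEquality V) (E : List (V × V)) where

  _⟶_ : V → V → Set
  u ⟶ v = (u , v) ∈ E

  data Walk : V → V → ℕ → Set where
    []  : ∀ {u} → Walk u u 0
    _◅_ : ∀ {u v w n} → u ⟶ v → Walk v w n → Walk u w (suc n)

  Acyclic : Set
  Acyclic = ∀ {u k} → ¬ Walk u u (suc k)

  InfiniteWalk : Set
  InfiniteWalk = Σ (ℕ → V) λ f → ∀ i → f i ⟶ f (suc i)

  departures : ∀ {u w n} → Walk u w n → List V
  departures [] = []
  departures (_◅_ {u} _ p) = u ∷ departures p

  length-departures : ∀ {u w n} (p : Walk u w n) → length (departures p) ≡ n
  length-departures [] = refl
  length-departures (_ ◅ p) = cong suc (length-departures p)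

  walkTo : ∀ {u w n z} (p : Walk u w n) → z ∈ departures p → ∃ λ m → Walk u z m
  walkTo (_ ◅ _) (here refl) = 0 , []
  walkTo (e ◅ p) (there z∈) = let m , q = walkTo p z∈ in suc m , e ◅ q

  departures-unique : Acyclic → ∀ {u w n} (p : Walk u w n) → Unique (departures p)
  departures-unique acyclic [] = []
  departures-unique acyclic (e ◅ p) =
    All.tabulate (λ { z∈ refl → acyclic (e ◅ proj₂ (walkTo p z∈)) }) ∷ departures-unique acyclic p

  departures⊆sources : ∀ {u w n z} (p : Walk u w n) → z ∈ departures p → z ∈ map proj₁ E
  departures⊆sources (e ◅ _) (here refl) = ∈-map⁺ proj₁ e
  departures⊆sources (_ ◅ p) (there z∈) = departures⊆sources p z∈

  walk-bound : Acyclic → ∀ {u w n} → Walk u w n → n ≤ length E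
  walk-bound acyclic {n = n} p = begin
    n                         ≡⟨ sym (length-departures p) ⟩
    length (departures p)     ≤⟨ unique⊆⇒length≤ (departures-unique acyclic p) (departures⊆sources p) ⟩
    length (map proj₁ E)      ≡⟨ length-map proj₁ E ⟩
    length E                  ∎
    where open ≤-Reasoning

  successors : V → List V
  successors u = map proj₂ (filter (λ e → proj₁ e ≟ u) E)

  successor⇒edge : ∀ {u v} → v ∈ successors u → u ⟶ v
  successor⇒edge {u} v∈ with ∈-map⁻ proj₂ v∈
  ... | (_ , _) , e∈ , refl with ∈-filter⁻ (λ e → proj₁ e ≟ u) e∈
  ... | e , refl = e

  edge⇒successor : ∀ {u v} → u ⟶ v → v ∈ successors u
  edge⇒successor {u} e = ∈-map⁺ proj₂ (∈-filter⁺ (λ e → proj₁ e ≟ u) e refl)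

  height : ℕ → V → ℕ
  height zero _ = 0
  height (suc n) u = max 0 (map (λ v → suc (height n v)) (successors u))

  height-attained : ∀ n u → ∃ λ w → Walk u w (height n u)
  height-attained zero u = u , []
  height-attained (suc n) u with argmax-sel id 0 (map (λ v → suc (height n v)) (successors u))
  ... | inj₁ height≡0 = u , subst (Walk u u) (sym height≡0) []
  ... | inj₂ height∈ with ∈-map⁻ (λ v → suc (height n v)) height∈
  ... | v , v∈ , height≡ =
    let w , p = height-attained n v
    in w , subst (Walk u w) (sym height≡) (successor⇒edge v∈ ◅ p)

  height-maximal : ∀ {n u w k} → Walk u w k → k ≤ n → k ≤ height n u
  height-maximal [] _ = z≤n
  height-maximal {suc n} (e ◅ p) (s≤s k≤n) =
    ≤-trans (s≤s (height-maximal p k≤n))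
            (All.lookup (xs≤max 0 _) (∈-map⁺ (λ v → suc (height n v)) (edge⇒successor e)))

  -- The height with enough steps to cover every walk of an acyclic graph.
  rank : V → ℕ
  rank = height (length E)

  rank-decreasing : Acyclic → ∀ {u v} → u ⟶ v → rank v < rank u
  rank-decreasing acyclic {v = v} e =
    let _ , p = height-attained (length E) v
        longer = e ◅ p
    in height-maximal longer (walk-bound acyclic longer)

  module _ {u k} (cycle : Walk u u (suc k)) where

    Tour : Set
    Tour = Σ V λ v → Σ ℕ λ n → Walk v u (suc n)

    advance : Tour → Tour
    advance (_ , zero , _ ◅ []) = u , k , cycle
    advance (_ , suc n , _ ◅ p) = _ , n , p

    advance-edge : (t : Tour) → proj₁ t ⟶ proj₁ (advance t)
    advance-edge (_ , zero , e ◅ []) = e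
    advance-edge (_ , suc n , e ◅ _) = e

    tour : ℕ → Tour
    tour zero = u , k , cycle
    tour (suc i) = advance (tour i)

    unroll : InfiniteWalk
    unroll = (λ i → proj₁ (tour i)) , (λ i → advance-edge (tour i))

pairs : List A → List (A × A)
pairs [] = []
pairs (x ∷ xs) = map (x ,_) xs ++ map (_, x) xs ++ pairs xs

pair-head : x ∈ xs → (y , x) ∈ pairs (y ∷ xs)
pair-head x∈ = ∈-++⁺ˡ (∈-map⁺ _ x∈)

pair-last : x ∈ xs → (x , y) ∈ pairs (y ∷ xs)
pair-last {xs = xs} x∈ = ∈-++⁺ʳ (map _ xs) (∈-++⁺ˡ (∈-map⁺ _ x∈))

pair-tail : {p : A × A} (xs : List A) → p ∈ pairs xs → p ∈ pairs (y ∷ xs)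
pair-tail xs p∈ = ∈-++⁺ʳ (map _ xs) (∈-++⁺ʳ (map _ xs) p∈)

pairs⁻ : (y : A) (xs : List A) {p : A × A} → p ∈ pairs (y ∷ xs) →
  (∃ λ x → x ∈ xs × p ≡ (y , x)) ⊎ (∃ λ x → x ∈ xs × p ≡ (x , y)) ⊎ p ∈ pairs xs
pairs⁻ y xs p∈ with ∈-++⁻ (map (y ,_) xs) p∈
... | inj₁ p∈₁ = inj₁ (∈-map⁻ _ p∈₁)
... | inj₂ p∈′ with ∈-++⁻ (map (_, y) xs) p∈′
...   | inj₁ p∈₂ = inj₂ (inj₁ (∈-map⁻ _ p∈₂))
...   | inj₂ p∈₃ = inj₂ (inj₂ p∈₃)

pairs-swap : {x y : A} (xs : List A) → (x , y) ∈ pairs xs → (y , x) ∈ pairs xs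
pairs-swap (z ∷ zs) p∈ with pairs⁻ z zs p∈
... | inj₁ (_ , x∈ , refl) = pair-last x∈
... | inj₂ (inj₁ (_ , x∈ , refl)) = pair-head x∈
... | inj₂ (inj₂ p∈₃) = pair-tail zs (pairs-swap zs p∈₃)

pairs-↭ : {x y : A} {xs : List A} → (x , y) ∈ pairs xs → ∃ λ R → xs ↭ x ∷ y ∷ R
pairs-↭ {xs = z ∷ zs} p∈ with pairs⁻ z zs p∈
... | inj₁ (_ , w∈ , refl) = let R , ↭R = ∈⇒↭ w∈ in R , ↭-prep z ↭R
... | inj₂ (inj₁ (w , w∈ , refl)) = let R , ↭R = ∈⇒↭ w∈ in R , ↭-trans (↭-prep z ↭R) (↭-swap z w ↭-refl)
pairs-↭ {x = x} {y = y} {xs = z ∷ zs} p∈ | inj₂ (inj₂ p∈₃) =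
  let R , ↭R = pairs-↭ p∈₃ in z ∷ R , ↭-trans (↭-prep z ↭R) (↭-sym (shift z (x ∷ y ∷ []) R))

at-most-one : {P : B → Set} (P? : Decidable P) (f : A → B) (xs : List A) →
  (∀ {x y} → (x , y) ∈ pairs xs → P (f x) → P (f y) → ⊥) →
  length (filter P? (map f xs)) ≤ 1
at-most-one P? f [] _ = z≤n
at-most-one P? f (x ∷ xs) exclusive with P? (f x)
... | yes Px = s≤s (≤-reflexive (cong length (filter-none P? (All-map⁺ none))))
  where
  none : All (λ z → ¬ _) xs
  none = All.tabulate (λ z∈ Pz → exclusive (pair-head z∈) Px Pz)
... | no _ = at-most-one P? f xs (λ p∈ → exclusive (pair-tail xs p∈))

neg : Literal → Literal
neg (lit v b) = lit v (not b)

neg-involutive : (l : Literal) → neg (neg l) ≡ l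
neg-involutive (lit v b) = cong (lit v) (not-involutive b)

_≟ˡ_ : DecidableEquality Literal
lit v b ≟ˡ lit w c = map′ (λ { (refl , refl) → refl }) (λ { refl → refl , refl }) ((v ℕ.≟ w) ×-dec (b Bool.≟ c))

resolve : ∀ {c d C D} (l : Literal) → c ↭ neg l ∷ C → d ↭ l ∷ D → Resolvent c d (D ++ C)
resolve {C = C} {D} (lit p true) c↭ d↭ = inj₂ (p , D , C , d↭ , c↭ , ↭-refl)
resolve {C = C} {D} (lit p false) c↭ d↭ = inj₁ (p , C , D , c↭ , d↭ , ++-comm D C)

implications : List Clause → List (Literal × Literal)
implications 𝒞 = concatMap (λ c → map (map₂ neg) (pairs c)) 𝒞

implication : ∀ {𝒞 c x y} → c ∈ 𝒞 → (x , y) ∈ pairs c → (x , neg y) ∈ implications 𝒞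
implication c∈ xy∈ = ∈-concatMap⁺ _ (lose c∈ (∈-map⁺ (map₂ neg) xy∈))

record Link (𝒞 : List Clause) (a b : Literal) : Set where
  field
    clause : Clause
    member : clause ∈ 𝒞
    others : Clause
    shape  : clause ↭ a ∷ neg b ∷ others

link : ∀ {𝒞 a b} → (a , b) ∈ implications 𝒞 → Link 𝒞 a b
link {𝒞} e with find (∈-concatMap⁻ _ {xs = 𝒞} e)
... | c , c∈ , e∈ with ∈-map⁻ (map₂ neg) e∈
... | (x , y) , xy∈ , refl =
  let R , c↭ = pairs-↭ xy∈
  in record { clause = c ; member = c∈ ; others = R
            ; shape = subst (λ z → c ↭ x ∷ z ∷ R) (sym (neg-involutive y)) c↭ }

-- An infinite walk f₀ ⟶ f₁ ⟶ … in the implication graph yields an infinite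
-- resolution sequence: the i-th resolvent always contains ¬fᵢ₊₁, and is
-- resolved on it against the clause fᵢ₊₁ ∨ ¬fᵢ₊₂ ∨ … behind the next edge.
module _ (𝒞 : List Clause) (f : ℕ → Literal) (walk : ∀ i → (f i , f (suc i)) ∈ implications 𝒞) where

  private
    module L (i : ℕ) = Link (link {𝒞} (walk i))

  -- The resolvent minus its literal ¬fᵢ₊₁.
  rest : ℕ → Clause
  rest zero = f 0 ∷ L.others 0
  rest (suc i) = L.others (suc i) ++ rest i

  resolvents : ℕ → Clause
  resolvents zero = L.clause 0
  resolvents (suc i) = neg (f (suc (suc i))) ∷ rest (suc i)

  resolvents-shape : ∀ i → resolvents i ↭ neg (f (suc i)) ∷ rest i
  resolvents-shape zero = ↭-trans (L.shape 0) (↭-swap (f 0) _ ↭-refl)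
  resolvents-shape (suc i) = ↭-refl

  walk⇒infinite-sequence : Σ (ℕ → Clause) (InfiniteSequence 𝒞)
  walk⇒infinite-sequence = resolvents , L.member 0 , λ i →
    L.clause (suc i) , L.member (suc i) , resolve (f (suc i)) (resolvents-shape i) (L.shape (suc i))

renamingBy : (Literal → ℕ) → Var → Bool
renamingBy r v = r (lit v false) ≤ᵇ r (lit v true)

renamed-positive : (r : Literal → ℕ) (l : Literal) →
  T (positive (renameLit (renamingBy r) l)) → r l ≤ r (neg l)
renamed-positive r (lit v b) _ with r (lit v false) ≤ᵇ r (lit v true) in flip
renamed-positive r (lit v true)  ()  | true
renamed-positive r (lit v true)  _   | false = <⇒≤ (≰⇒> (λ le → subst T flip (≤⇒≤ᵇ le)))
renamed-positive r (lit v false) _   | true  = ≤ᵇ⇒≤ _ _ (subst T (sym flip) tt)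
renamed-positive r (lit v false) ()  | false

theorem2 : (𝒞 : List Clause) → Termination 𝒞 → RenamableHorn 𝒞
theorem2 𝒞 termination = renamingBy rank , All-map⁺ (All.tabulate horn)
  where
  open Graph _≟ˡ_ (implications 𝒞)

  acyclic : Acyclic
  acyclic cycle = let f , walk = unroll cycle in termination (walk⇒infinite-sequence 𝒞 f walk)

  Positive : Literal → Set
  Positive l = T (positive (renameLit (renamingBy rank) l))

  no-two-positive : ∀ {c x y} → c ∈ 𝒞 → (x , y) ∈ pairs c → Positive x → Positive y → ⊥
  no-two-positive {c} {x} {y} c∈ xy∈ Px Py = <-irrefl refl (begin-strict
    rank x        ≤⟨ renamed-positive rank x Px ⟩
    rank (neg x)  <⟨ rank-decreasing acyclic (implication c∈ (pairs-swap c xy∈)) ⟩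
    rank y        ≤⟨ renamed-positive rank y Py ⟩
    rank (neg y)  <⟨ rank-decreasing acyclic (implication c∈ xy∈) ⟩
    rank x        ∎)
    where open ≤-Reasoning

  horn : ∀ {c} → c ∈ 𝒞 → Horn (renameClause (renamingBy rank) c)
  horn {c} c∈ = at-most-one (λ l → Bool.T? (positive l)) (renameLit (renamingBy rank)) c (no-two-positive c∈)
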